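{- Let $r,p,q,n$ be positive integers with $p\mid r$, $q\mid r$, $pq\mid rn$ and $n\neq 2$, and let $G=G(r,p,q,n)$, $G^*=G(r,q,p,n)$. Then $G\cong G^*$ if and only if $G$ and $G^*$ have the same number of scalar elements.
   Context: $G(r,n)$ is the group of $n\times n$ complex matrices with exactly one nonzero entry in each row and column, each an $r$-th root of unity. For $p\mid r$, $G(r,p,n)$ is the subgroup of $A\in G(r,n)$ with $\det A/\det|A|$ an $(r/p)$-th root of unity ($|A|$ the matrix of absolute values). For $q\mid r$, $pq\mid rn$, $G(r,p,q,n)=G(r,p,n)/C_q$ with $C_q=\langle e^{2\pi i/q}I\rangle$. A scalar element of $G(r,p,q,n)$ is an element represented by a scalar matrix. -}

module Defs where

open import Data.Nat using (ℕ; zero; suc)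
open import Data.Integer using (ℤ; +_; _+_; _-_; _*_; 0ℤ)
open import Data.Integer.Divisibility using (_∣_)
open import Data.Fin using (Fin; zero; suc)
open import Data.Fin.Permutation using (Permutation′; _⟨$⟩ʳ_; _∘ₚ_)
open import Data.Product using (Σ; ∃; _×_; _,_; proj₁; proj₂)
open import Relation.Binary.PropositionalEquality using (_≡_)

sumℤ : {n : ℕ} → (Fin n → ℤ) → ℤ
sumℤ {zero}  f = 0ℤ
sumℤ {suc n} f = f zero + sumℤ (λ i → f (suc i))

-- A monomial matrix with entries r-th roots of unity, ζ = e^{2πi/r}:
-- (σ , a) represents the matrix whose only nonzero entry in row i is
-- ζ^(a i), placed in column σ i.  Exponents are integers read modulo r.
Mono : ℕ → Set
Mono n = Permutation′ n × (Fin n → ℤ)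

perm : {n : ℕ} → Mono n → Permutation′ n
perm = proj₁

exps : {n : ℕ} → Mono n → Fin n → ℤ
exps = proj₂

-- Matrix product: (σ,a)(τ,b) has entry ζ^(a i + b (σ i)) at (i, τ (σ i)).
mul : {n : ℕ} → Mono n → Mono n → Mono n
mul (σ , a) (τ , b) = (σ ∘ₚ τ) , (λ i → a i + b (σ ⟨$⟩ʳ i))

-- Membership in G(r,p,n): det A / det |A| = ζ^(Σ a i) is an (r/p)-th root of
-- unity, i.e. (since p ∣ r) p divides Σ a i.
InG : (p : ℕ) {n : ℕ} → Mono n → Set
InG p x = (+ p) ∣ sumℤ (exps x)

-- Equality in G(r,p,q,n) = G(r,p,n)/C_q, C_q = ⟨ e^{2πi/q} I ⟩:
-- x = (ζ^c I) y for some c with ζ^c a q-th root of unity (r ∣ q c).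
QEq : (r q : ℕ) {n : ℕ} → Mono n → Mono n → Set
QEq r q x y = (∀ i → perm x ⟨$⟩ʳ i ≡ perm y ⟨$⟩ʳ i)
            × Σ ℤ (λ c → ((+ r) ∣ ((+ q) * c))
                       × (∀ i → (+ r) ∣ (exps x i - exps y i - c)))

-- The group G(r,p,q,n): carrier {x : Mono n | InG p x}, equality QEq r q,
-- multiplication mul.
record GroupIso (r p q r' p' q' n : ℕ) : Set where
  field
    f     : Mono n → Mono n
    f-mem : ∀ x → InG p x → InG p' (f x)
    f-cong : ∀ x y → InG p x → InG p y → QEq r q x y → QEq r' q' (f x) (f y)
    f-hom : ∀ x y → InG p x → InG p y →
            QEq r' q' (f (mul x y)) (mul (f x) (f y))
    f-inj : ∀ x y → InG p x → InG p y → QEq r' q' (f x) (f y) → QEq r q x y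
    f-surj : ∀ y → InG p' y → Σ (Mono n) (λ x → InG p x × QEq r' q' (f x) y)

IsScalarMat : (r : ℕ) {n : ℕ} → Mono n → Set
IsScalarMat r x = (∀ i → perm x ⟨$⟩ʳ i ≡ i)
                × Σ ℤ (λ c → ∀ i → (+ r) ∣ (exps x i - c))

ScalarCount : (r p q n m : ℕ) → Set
ScalarCount r p q n m =
  Σ (Fin m → Mono n) λ g →
      (∀ k → InG p (g k) × IsScalarMat r (g k))
    × (∀ k l → QEq r q (g k) (g l) → k ≡ l)
    × (∀ x → InG p x → IsScalarMat r x → Σ (Fin m) (λ k → QEq r q x (g k)))

module Submission where

-- For x in G(r,p,n) the exponent sum Σa is a multiple of p; put s(x) = Σa / p.  When
-- p + n k = q A, the twist x ↦ ζ^(k s(x)) x multiplies Σa by q A / p, so it maps G(r,p,n) into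
-- G(r,q,n); it is multiplicative because s is additive, and it maps C_q into C_p.  When also
-- q + n k′ = p B, twisting back with k′ returns x times the scalar ζ^(s(x) X), where
-- X = q k + p k′ + n k k′, and (p + n k)(q + n k′) = p q + n X shows r ∣ X once A B ≡ 1 modulo
-- r n / (p q).  Writing g = gcd(p,n), p = p′g, n = n′g, such k, A, k′, B exist as soon as g
-- also divides q with q/g coprime to n′, i.e. gcd(q,n) = g.
-- The scalars of G(r,p,q,n) are the ζ^(p′ j) I with j < r / (q p′) = r g / (p q), so equal
-- scalar counts force gcd(p,n) = gcd(q,n).  Conversely, for n ≠ 2 a central element commutes
-- with every transposition and is therefore scalar; an isomorphism preserves the centre, hence
-- the number of scalar elements.

open import Defs
open import Data.Nat.Base as ℕ using (ℕ; zero; suc; NonZero; ≢-nonZero; ≢-nonZero⁻¹)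
import Data.Nat.Properties as ℕₚ
open import Data.Nat.Divisibility as ℕ∣ using () renaming (_∣_ to _∣ℕ_)
open import Data.Nat.Coprimality as ℕC using (Coprime)
open import Data.Nat.GCD using (gcd; gcd[m,n]∣m; gcd[m,n]∣n; gcd[m,n]≡0⇒m≡0; gcd[m,n]≢0; module Bézout)
open import Data.Nat.DivMod using (_/_; m/n*n≡m)
open import Data.Nat.Induction using (<-rec)
import Data.Nat.Tactic.RingSolver as ℕ-Solver
open import Data.Integer.Base using (ℤ; +_; 0ℤ; 1ℤ; _+_; _-_; _*_; -_; ∣_∣; _⊖_)
open import Data.Integer.Properties
  using (+-0-commutativeMonoid; +-injective; +-identityˡ; +-inverseʳ; *-assoc; *-comm; *-zeroˡ; *-zeroʳ;
         *-distribˡ-+; *-distribʳ-+; *-cancelˡ-≡; *-cancelʳ-≡; pos-+; pos-*; abs-*; +∣i∣≡i⊎+∣i∣≡-i;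
         i-j≡0⇒i≡j; m-n≡m⊖n; ∣i∣≡0⇒i≡0; ∣m⊝n∣≤m⊔n)
open import Data.Integer.DivMod using (_%ℕ_; _/ℕ_; n%ℕd<d; a≡a%ℕn+[a/ℕn]*n)
open import Data.Integer.Divisibility using () renaming (_∣_ to _∣ᵤ_)
open import Data.Integer.Divisibility.Signed
  using (_∣_; divides; quotient; ∣ᵤ⇒∣; ∣⇒∣ᵤ; ∣-refl; ∣-trans; ∣m∣n⇒∣m+n; ∣m∣n⇒∣m-n; ∣m⇒∣-m;
         ∣n⇒∣m*n; ∣m⇒∣m*n; *-cancelˡ-∣)
import Data.Integer.Coprimality as ℤC
open import Data.Integer.Tactic.RingSolver using (solve-∀; solve)
open import Data.List.Base using (_∷_; [])
open import Data.Fin.Base using (Fin; zero; suc; toℕ; fromℕ<; punchIn; punchOut)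
open import Data.Fin.Properties
  using (_≟_; toℕ-injective; toℕ-fromℕ<; toℕ<n; injective⇒≤; punchIn-injective; punchIn-punchOut; punchInᵢ≢i)
open import Data.Fin.Permutation using (Permutation′; _⟨$⟩ʳ_; transpose; id)
open import Data.Product using (Σ; _×_; _,_; proj₁; proj₂)
open import Data.Sum using (inj₁; inj₂)
open import Function.Base using (_∘_; case_of_)
open import Function.Bundles using (_⇔_; mk⇔)
open import Relation.Binary.Bundles using (Setoid)
open import Relation.Binary.Structures using (IsEquivalence)
open import Relation.Binary.PropositionalEquality
  using (_≡_; _≢_; refl; sym; trans; cong; cong₂; subst; subst₂; module ≡-Reasoning)
open import Relation.Nullary using (yes; no; contradiction)
open import Relation.Nullary.Decidable using (dec-true; dec-false)
import Algebra.Properties.CommutativeMonoid.Sum as MonoidSum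

-- Defs states divisibility of integers through absolute values; the library's lemmas are about
-- the signed relation.  Both arguments are explicit: the unsigned relation unfolds to
-- divisibility of absolute values, from which neither can be inferred.
signed : ∀ k i → k ∣ᵤ i → k ∣ i
signed k i = ∣ᵤ⇒∣

∣-zero : ∀ {k e} → e ≡ 0ℤ → k ∣ e
∣-zero {k} e≡0 = divides 0ℤ (trans e≡0 (sym (*-zeroˡ k)))

∣ᵤ-zero : ∀ k {e} → e ≡ 0ℤ → k ∣ᵤ e
∣ᵤ-zero k e≡0 = ∣⇒∣ᵤ (∣-zero {k} e≡0)

∣-≡ : ∀ {k e e′} → e ≡ e′ → k ∣ e → k ∣ e′
∣-≡ refl k∣e = k∣e

≡-by-relation : ∀ {a b u v} m → a - b ≡ m * (u - v) → u ≡ v → a ≡ b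
≡-by-relation {a} {b} {u} m a-b≡m[u-v] refl =
  i-j≡0⇒i≡j a b (trans a-b≡m[u-v] (trans (cong (_*_ m) (+-inverseʳ u)) (*-zeroʳ m)))

<-∣-sub⇒≡ : ∀ {d k l} → k ℕ.< d → l ℕ.< d → + d ∣ + k - + l → k ≡ l
<-∣-sub⇒≡ {d} {k} {l} k<d l<d d∣k-l with ∣ k ⊖ l ∣ ℕₚ.≟ 0
... | yes ∣k⊖l∣≡0 = +-injective (i-j≡0⇒i≡j (+ k) (+ l) (trans (m-n≡m⊖n k l) (∣i∣≡0⇒i≡0 ∣k⊖l∣≡0)))
... | no  ∣k⊖l∣≢0 = contradiction (subst (λ z → d ∣ℕ ∣ z ∣) (m-n≡m⊖n k l) (∣⇒∣ᵤ d∣k-l))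
                      (ℕ∣.>⇒∤ {{≢-nonZero ∣k⊖l∣≢0}} (ℕₚ.≤-<-trans (∣m⊝n∣≤m⊔n k l) (ℕₚ.⊔-lub k<d l<d)))

/ℕ-exact : ∀ d .{{_ : NonZero d}} i → + d ∣ i → i ≡ i /ℕ d * + d
/ℕ-exact d i d∣i with i %ℕ d ℕₚ.≟ 0
... | yes i%d≡0 = trans (a≡a%ℕn+[a/ℕn]*n i d)
  (trans (cong (λ m → + m + i /ℕ d * + d) i%d≡0) (+-identityˡ (i /ℕ d * + d)))
... | no  i%d≢0 = contradiction (∣⇒∣ᵤ d∣i%d) (ℕ∣.>⇒∤ {{≢-nonZero i%d≢0}} (n%ℕd<d i d))
  where
  d∣i%d : + d ∣ + (i %ℕ d)
  d∣i%d = ∣-≡ (lemma i (+ (i %ℕ d)) (i /ℕ d * + d) (a≡a%ℕn+[a/ℕn]*n i d))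
               (∣m∣n⇒∣m-n d∣i (∣n⇒∣m*n (i /ℕ d) (∣-refl {+ d})))
    where
    lemma : ∀ i m t → i ≡ m + t → i - t ≡ m
    lemma i m t refl = solve (m ∷ t ∷ [])

module ℤΣ = MonoidSum +-0-commutativeMonoid

sumℤ≗sum : ∀ {n} (f : Fin n → ℤ) → sumℤ f ≡ ℤΣ.sum f
sumℤ≗sum {zero}  f = refl
sumℤ≗sum {suc n} f = cong (_+_ (f zero)) (sumℤ≗sum (λ i → f (suc i)))

sumℤ-+ : ∀ {n} (f g : Fin n → ℤ) → sumℤ (λ i → f i + g i) ≡ sumℤ f + sumℤ g
sumℤ-+ f g = trans (sumℤ≗sum (λ i → f i + g i))
  (trans (ℤΣ.∑-distrib-+ f g) (sym (cong₂ _+_ (sumℤ≗sum f) (sumℤ≗sum g))))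

sumℤ-permute : ∀ {n} (f : Fin n → ℤ) (π : Permutation′ n) → sumℤ f ≡ sumℤ (λ i → f (π ⟨$⟩ʳ i))
sumℤ-permute f π = trans (sumℤ≗sum f)
  (trans (ℤΣ.sum-permute f π) (sym (sumℤ≗sum (λ i → f (π ⟨$⟩ʳ i)))))

sumℤ-const : ∀ n (c : ℤ) → sumℤ {n} (λ _ → c) ≡ + n * c
sumℤ-const zero    c = sym (*-zeroˡ c)
sumℤ-const (suc n) c = trans (cong (_+_ c) (sumℤ-const n c)) (lemma c (+ n))
  where
  lemma : ∀ c m → c + m * c ≡ (1ℤ + m) * c
  lemma = solve-∀

sumℤ-sub : ∀ {n} (f g : Fin n → ℤ) → sumℤ (λ i → f i - g i) ≡ sumℤ f - sumℤ g
sumℤ-sub {zero}  f g = refl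
sumℤ-sub {suc n} f g =
  trans (cong (_+_ (f zero - g zero)) (sumℤ-sub (λ i → f (suc i)) (λ i → g (suc i))))
        (lemma (f zero) (g zero) (sumℤ (λ i → f (suc i))) (sumℤ (λ i → g (suc i))))
  where
  lemma : ∀ f₀ g₀ F G → f₀ - g₀ + (F - G) ≡ (f₀ + F) - (g₀ + G)
  lemma = solve-∀

sumℤ-sub-const : ∀ {n} (f : Fin n → ℤ) (c : ℤ) → sumℤ (λ i → f i - c) ≡ sumℤ f - + n * c
sumℤ-sub-const {n} f c = trans (sumℤ-sub f (λ _ → c)) (cong (_-_ (sumℤ f)) (sumℤ-const n c))

sumℤ-∣ : ∀ {k n} (f : Fin n → ℤ) → (∀ i → k ∣ f i) → k ∣ sumℤ f
sumℤ-∣ {n = zero}  f k∣f = ∣-zero refl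
sumℤ-∣ {n = suc n} f k∣f = ∣m∣n⇒∣m+n (k∣f zero) (sumℤ-∣ (λ i → f (suc i)) (λ i → k∣f (suc i)))

sumℤ-exps-mul : ∀ {n} (x y : Mono n) → sumℤ (exps (mul x y)) ≡ sumℤ (exps x) + sumℤ (exps y)
sumℤ-exps-mul (σ , a) (τ , b) =
  trans (sumℤ-+ a (λ i → b (σ ⟨$⟩ʳ i))) (cong (_+_ (sumℤ a)) (sym (sumℤ-permute b σ)))

InG-mul : ∀ p {n} (x y : Mono n) → InG p x → InG p y → InG p (mul x y)
InG-mul p x y p∣x p∣y = ∣⇒∣ᵤ (∣-≡ (sym (sumℤ-exps-mul x y))
  (∣m∣n⇒∣m+n (signed (+ p) (sumℤ (exps x)) p∣x) (signed (+ p) (sumℤ (exps y)) p∣y)))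
module _ (r q : ℕ) {n : ℕ} where

  QEq-refl : (x : Mono n) → QEq r q x x
  QEq-refl (σ , a) =
    (λ _ → refl) , 0ℤ , ∣ᵤ-zero (+ r) (*-zeroʳ (+ q)) , λ i → ∣ᵤ-zero (+ r) (lemma (a i))
    where
    lemma : ∀ a → a - a - 0ℤ ≡ 0ℤ
    lemma = solve-∀

  QEq-sym : {x y : Mono n} → QEq r q x y → QEq r q y x
  QEq-sym {σ , a} {τ , b} (σ≗τ , c , r∣qc , r∣a-b-c) =
    (λ i → sym (σ≗τ i)) , - c ,
    ∣⇒∣ᵤ (∣-≡ (lemma₁ (+ q) c) (∣m⇒∣-m (signed (+ r) (+ q * c) r∣qc))) ,
    λ i → ∣⇒∣ᵤ (∣-≡ (lemma₂ (a i) (b i) c) (∣m⇒∣-m (signed (+ r) (a i - b i - c) (r∣a-b-c i))))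
    where
    lemma₁ : ∀ q c → - (q * c) ≡ q * - c
    lemma₁ = solve-∀
    lemma₂ : ∀ a b c → - (a - b - c) ≡ b - a - - c
    lemma₂ = solve-∀

  QEq-trans : {x y z : Mono n} → QEq r q x y → QEq r q y z → QEq r q x z
  QEq-trans {σ , a} {τ , b} {υ , d} (σ≗τ , c , r∣qc , r∣a-b-c) (τ≗υ , c′ , r∣qc′ , r∣b-d-c′) =
    (λ i → trans (σ≗τ i) (τ≗υ i)) , c + c′ ,
    ∣⇒∣ᵤ (∣-≡ (sym (*-distribˡ-+ (+ q) c c′))
              (∣m∣n⇒∣m+n (signed (+ r) (+ q * c) r∣qc) (signed (+ r) (+ q * c′) r∣qc′))) ,
    λ i → ∣⇒∣ᵤ (∣-≡ (lemma (a i) (b i) (d i) c c′)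
                    (∣m∣n⇒∣m+n (signed (+ r) (a i - b i - c) (r∣a-b-c i))
                               (signed (+ r) (b i - d i - c′) (r∣b-d-c′ i))))
    where
    lemma : ∀ a b d c c′ → (a - b - c) + (b - d - c′) ≡ a - d - (c + c′)
    lemma = solve-∀

  QEq-isEquivalence : IsEquivalence (QEq r q {n})
  QEq-isEquivalence = record
    { refl  = λ {x} → QEq-refl x
    ; sym   = λ {x} {y} → QEq-sym {x} {y}
    ; trans = λ {x} {y} {z} → QEq-trans {x} {y} {z}
    }

  QEq-setoid : Setoid _ _
  QEq-setoid = record { isEquivalence = QEq-isEquivalence }

  mul-congˡ : (x x′ y : Mono n) → QEq r q x x′ → QEq r q (mul x y) (mul x′ y)
  mul-congˡ (σ , a) (σ′ , a′) (τ , b) (σ≗σ′ , c , r∣qc , r∣a-a′-c) =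
    (λ i → cong (τ ⟨$⟩ʳ_) (σ≗σ′ i)) , c , r∣qc ,
    λ i → subst (λ j → + r ∣ᵤ (a i + b (σ ⟨$⟩ʳ i)) - (a′ i + b j) - c) (σ≗σ′ i)
                (∣⇒∣ᵤ (∣-≡ (lemma (a i) (a′ i) (b (σ ⟨$⟩ʳ i)) c)
                            (signed (+ r) (a i - a′ i - c) (r∣a-a′-c i))))
    where
    lemma : ∀ a a′ u c → a - a′ - c ≡ (a + u) - (a′ + u) - c
    lemma = solve-∀

  mul-congʳ : (x y y′ : Mono n) → QEq r q y y′ → QEq r q (mul x y) (mul x y′)
  mul-congʳ (σ , a) (τ , b) (τ′ , b′) (τ≗τ′ , c , r∣qc , r∣b-b′-c) =
    (λ i → τ≗τ′ (σ ⟨$⟩ʳ i)) , c , r∣qc ,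
    λ i → ∣⇒∣ᵤ (∣-≡ (lemma (a i) (b (σ ⟨$⟩ʳ i)) (b′ (σ ⟨$⟩ʳ i)) c)
                    (signed (+ r) _ (r∣b-b′-c (σ ⟨$⟩ʳ i))))
    where
    lemma : ∀ a u u′ c → u - u′ - c ≡ (a + u) - (a + u′) - c
    lemma = solve-∀

scalar-comm : ∀ r q {n} (x y : Mono n) → IsScalarMat r x → QEq r q (mul y x) (mul x y)
scalar-comm r q (σ , a) (τ , b) (σ≗id , c , r∣a-c) =
  (λ i → trans (σ≗id (τ ⟨$⟩ʳ i)) (cong (τ ⟨$⟩ʳ_) (sym (σ≗id i)))) , 0ℤ , ∣ᵤ-zero (+ r) (*-zeroʳ (+ q)) ,
  λ i → subst (λ j → + r ∣ᵤ (b i + a (τ ⟨$⟩ʳ i)) - (a i + b j) - 0ℤ) (sym (σ≗id i))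
          (∣⇒∣ᵤ (∣-≡ (lemma (a i) (a (τ ⟨$⟩ʳ i)) (b i) c)
                      (∣m∣n⇒∣m-n (signed (+ r) (a (τ ⟨$⟩ʳ i) - c) (r∣a-c (τ ⟨$⟩ʳ i)))
                                 (signed (+ r) (a i - c) (r∣a-c i)))))
  where
  lemma : ∀ a a′ b c → (a′ - c) - (a - c) ≡ (b + a′) - (a + b) - 0ℤ
  lemma = solve-∀

third-index : ∀ {n} → n ≢ 2 → (i j : Fin n) → i ≢ j → Σ (Fin n) λ k → k ≢ i × k ≢ j
third-index {1}               _   zero zero i≢j = contradiction refl i≢j
third-index {2}               n≢2 _    _    _   = contradiction refl n≢2
third-index {suc (suc (suc m))} _ i    j    i≢j = k , punchInᵢ≢i i _ , k≢j
  where
  j′ : Fin (suc (suc m))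
  j′ = punchOut i≢j
  k : Fin (suc (suc (suc m)))
  k = punchIn i (punchIn j′ zero)
  k≢j : k ≢ j
  k≢j k≡j = punchInᵢ≢i j′ zero
    (punchIn-injective i _ _ (trans k≡j (sym (punchIn-punchOut i≢j))))

transpose-matchˡ : ∀ {n} (i j : Fin n) → transpose i j ⟨$⟩ʳ i ≡ j
transpose-matchˡ i j rewrite dec-true (i ≟ i) refl = refl

transpose-fixed : ∀ {n} {i j k : Fin n} → k ≢ i → k ≢ j → transpose i j ⟨$⟩ʳ k ≡ k
transpose-fixed {i = i} {j} {k} k≢i k≢j rewrite dec-false (k ≟ i) k≢i | dec-false (k ≟ j) k≢j = refl

swap : ∀ {n} → Fin n → Fin n → Mono n
swap i j = transpose i j , λ _ → 0ℤ

InG-swap : ∀ p {n} (i j : Fin n) → InG p (swap i j)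
InG-swap p {n} i j = ∣ᵤ-zero (+ p) (trans (sumℤ-const n 0ℤ) (*-zeroʳ (+ n)))

IsCentral : (r p q : ℕ) {n : ℕ} → Mono n → Set
IsCentral r p q x = ∀ y → InG p y → QEq r q (mul y x) (mul x y)

module _ {r p q n : ℕ} (n≢2 : n ≢ 2) (x : Mono n) (central : IsCentral r p q x) where
  private
    σ : Permutation′ n
    σ = perm x
    a : Fin n → ℤ
    a = exps x

  central⇒perm-id : ∀ i → σ ⟨$⟩ʳ i ≡ i
  central⇒perm-id i with σ ⟨$⟩ʳ i ≟ i
  ... | yes σi≡i = σi≡i
  ... | no  σi≢i with third-index n≢2 (σ ⟨$⟩ʳ i) i σi≢i
  ...   | k , k≢σi , k≢i = contradiction (sym σi≡k) k≢σi
    where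
    t : Permutation′ n
    t = transpose (σ ⟨$⟩ʳ i) k
    σi≡k : σ ⟨$⟩ʳ i ≡ k
    σi≡k = begin
      σ ⟨$⟩ʳ i                ≡⟨ cong (σ ⟨$⟩ʳ_) (transpose-fixed (σi≢i ∘ sym) (k≢i ∘ sym)) ⟨
      σ ⟨$⟩ʳ (t ⟨$⟩ʳ i)       ≡⟨ proj₁ (central (swap (σ ⟨$⟩ʳ i) k) (InG-swap p (σ ⟨$⟩ʳ i) k)) i ⟩
      t ⟨$⟩ʳ (σ ⟨$⟩ʳ i)       ≡⟨ transpose-matchˡ (σ ⟨$⟩ʳ i) k ⟩
      k                       ∎
      where open ≡-Reasoning

  central⇒exps-≡ : ∀ i j → + r ∣ a i - a j
  central⇒exps-≡ i j with i ≟ j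
  ... | yes refl = ∣-zero (+-inverseʳ (a i))
  ... | no  i≢j with third-index n≢2 i j i≢j
  ...   | k , k≢i , k≢j = ∣-≡ (lemma (a i) (a j) (a k) c) (∣m∣n⇒∣m-n r∣at-j r∣at-k)
    where
    t : Permutation′ n
    t = transpose j i
    c : ℤ
    c = proj₁ (proj₂ (central (swap j i) (InG-swap p j i)))
    r∣at : ∀ l → + r ∣ 0ℤ + a (t ⟨$⟩ʳ l) - (a l + 0ℤ) - c
    r∣at l = signed (+ r) _ (proj₂ (proj₂ (proj₂ (central (swap j i) (InG-swap p j i)))) l)
    r∣at-j : + r ∣ 0ℤ + a i - (a j + 0ℤ) - c
    r∣at-j = subst (λ l → + r ∣ 0ℤ + a l - (a j + 0ℤ) - c) (transpose-matchˡ j i) (r∣at j)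
    r∣at-k : + r ∣ 0ℤ + a k - (a k + 0ℤ) - c
    r∣at-k = subst (λ l → + r ∣ 0ℤ + a l - (a k + 0ℤ) - c) (transpose-fixed k≢j k≢i) (r∣at k)
    lemma : ∀ aᵢ aⱼ aₖ c → (0ℤ + aᵢ - (aⱼ + 0ℤ) - c) - (0ℤ + aₖ - (aₖ + 0ℤ) - c) ≡ aᵢ - aⱼ
    lemma = solve-∀

  central⇒scalar : IsScalarMat r x
  central⇒scalar = central⇒perm-id , constant n a central⇒exps-≡
    where
    constant : ∀ m (b : Fin m → ℤ) → (∀ i j → + r ∣ b i - b j) → Σ ℤ λ c → ∀ i → + r ∣ᵤ b i - c
    constant zero    b _      = 0ℤ , λ ()
    constant (suc m) b r∣b-b = b zero , λ i → ∣⇒∣ᵤ (r∣b-b i zero)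

module _ {r p q n : ℕ} (iso : GroupIso r p q r q p n) where
  open GroupIso iso
  open import Relation.Binary.Reasoning.Setoid (QEq-setoid r p {n})

  iso-scalar⇒central : ∀ x → InG p x → IsScalarMat r x → IsCentral r q p (f x)
  iso-scalar⇒central x x∈G x-scalar y y∈G* = begin
    mul y (f x)       ≈⟨ mul-congˡ r p (f z) y (f x) fz≈y ⟨
    mul (f z) (f x)   ≈⟨ f-hom z x z∈G x∈G ⟨
    f (mul z x)       ≈⟨ f-cong (mul z x) (mul x z) (InG-mul p z x z∈G x∈G) (InG-mul p x z x∈G z∈G)
                                (scalar-comm r q x z x-scalar) ⟩
    f (mul x z)       ≈⟨ f-hom x z x∈G z∈G ⟩
    mul (f x) (f z)   ≈⟨ mul-congʳ r p (f x) (f z) y fz≈y ⟩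
    mul (f x) y       ∎
    where
    z : Mono n
    z = proj₁ (f-surj y y∈G*)
    z∈G : InG p z
    z∈G = proj₁ (proj₂ (f-surj y y∈G*))
    fz≈y : QEq r p (f z) y
    fz≈y = proj₂ (proj₂ (f-surj y y∈G*))

  iso-preimage-central : ∀ x y → InG p x → IsScalarMat r y → QEq r p (f x) y → IsCentral r p q x
  iso-preimage-central x y x∈G y-scalar fx≈y w w∈G =
    f-inj (mul w x) (mul x w) (InG-mul p w x w∈G x∈G) (InG-mul p x w x∈G w∈G) (begin
      f (mul w x)       ≈⟨ f-hom w x w∈G x∈G ⟩
      mul (f w) (f x)   ≈⟨ mul-congʳ r p (f w) (f x) y fx≈y ⟩
      mul (f w) y       ≈⟨ scalar-comm r p y (f w) y-scalar ⟩
      mul y (f w)       ≈⟨ mul-congˡ r p (f x) y (f w) fx≈y ⟨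
      mul (f x) (f w)   ≈⟨ f-hom x w x∈G w∈G ⟨
      f (mul x w)       ∎)

  iso-ScalarCount : n ≢ 2 → ∀ {m} → ScalarCount r p q n m → ScalarCount r q p n m
  iso-ScalarCount n≢2 {m} (g , g-scalar , g-injective , g-surjective) =
    (λ k → f (g k)) , fg-scalar , fg-injective , fg-surjective
    where
    fg-scalar : ∀ k → InG q (f (g k)) × IsScalarMat r (f (g k))
    fg-scalar k = f-mem (g k) (proj₁ (g-scalar k)) ,
      central⇒scalar {q = p} n≢2 (f (g k)) (iso-scalar⇒central (g k) (proj₁ (g-scalar k)) (proj₂ (g-scalar k)))
    fg-injective : ∀ k l → QEq r p (f (g k)) (f (g l)) → k ≡ l
    fg-injective k l fgk≈fgl =
      g-injective k l (f-inj (g k) (g l) (proj₁ (g-scalar k)) (proj₁ (g-scalar l)) fgk≈fgl)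
    fg-surjective : ∀ y → InG q y → IsScalarMat r y → Σ (Fin m) λ k → QEq r p y (f (g k))
    fg-surjective y y∈G* y-scalar = k , (begin
      y          ≈⟨ fx≈y ⟨
      f x        ≈⟨ f-cong x (g k) x∈G (proj₁ (g-scalar k)) x≈gk ⟩
      f (g k)    ∎)
      where
      x : Mono n
      x = proj₁ (f-surj y y∈G*)
      x∈G : InG p x
      x∈G = proj₁ (proj₂ (f-surj y y∈G*))
      fx≈y : QEq r p (f x) y
      fx≈y = proj₂ (proj₂ (f-surj y y∈G*))
      x-scalar : IsScalarMat r x
      x-scalar = central⇒scalar {q = q} n≢2 x (iso-preimage-central x y x∈G y-scalar fx≈y)
      k : Fin m
      k = proj₁ (g-surjective x x∈G x-scalar)
      x≈gk : QEq r q x (g k)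
      x≈gk = proj₂ (g-surjective x x∈G x-scalar)

ScalarCount-≤ : ∀ r p q n {m m′} → ScalarCount r p q n m → ScalarCount r p q n m′ → m ℕ.≤ m′
ScalarCount-≤ r p q n {m} {m′} (g , g-scalar , g-injective , _) (g′ , _ , _ , g′-surjective) =
  injective⇒≤ index-injective
  where
  open import Relation.Binary.Reasoning.Setoid (QEq-setoid r q {n})
  index : Fin m → Fin m′
  index k = proj₁ (g′-surjective (g k) (proj₁ (g-scalar k)) (proj₂ (g-scalar k)))
  g≈g′∘index : ∀ k → QEq r q (g k) (g′ (index k))
  g≈g′∘index k = proj₂ (g′-surjective (g k) (proj₁ (g-scalar k)) (proj₂ (g-scalar k)))
  index-injective : ∀ {k l} → index k ≡ index l → k ≡ l
  index-injective {k} {l} index-k≡index-l = g-injective k l (begin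
    g k             ≈⟨ g≈g′∘index k ⟩
    g′ (index k)    ≡⟨ cong g′ index-k≡index-l ⟩
    g′ (index l)    ≈⟨ g≈g′∘index l ⟨
    g l             ∎)

ScalarCount-unique : ∀ r p q n {m m′} → ScalarCount r p q n m → ScalarCount r p q n m′ → m ≡ m′
ScalarCount-unique r p q n count count′ =
  ℕₚ.≤-antisym (ScalarCount-≤ r p q n count count′) (ScalarCount-≤ r p q n count′ count)

-- p′ generates {c : p ∣ n c}, the exponents of the scalars ζ^c I lying in G(r,p,n); modulo C_q
-- these are the ζ^(p′ j) I with j < M.
ScalarCount-of-generator :
  ∀ {r p q n M p′} .{{_ : NonZero q}} .{{_ : NonZero M}} .{{_ : NonZero p′}} .{{_ : NonZero n}} →
  + r ≡ + q * (+ M * + p′) → + p ∣ + r →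
  + p ∣ + n * + p′ → (∀ c → + p ∣ + n * c → + p′ ∣ c) →
  ScalarCount r p q n M
ScalarCount-of-generator {r} {p} {q} {n} {M} {p′} r≡qMp′ p∣r p∣np′ p∣nc⇒p′∣c =
  scalar , scalar-in-G , scalar-injective , scalar-surjective
  where
  e : Fin M → ℤ
  e k = + p′ * + toℕ k

  scalar : Fin M → Mono n
  scalar k = id , λ _ → e k

  scalar-in-G : ∀ k → InG p (scalar k) × IsScalarMat r (scalar k)
  scalar-in-G k =
    ∣⇒∣ᵤ (∣-≡ (trans (*-assoc (+ n) (+ p′) (+ toℕ k)) (sym (sumℤ-const n (e k))))
              (∣m⇒∣m*n (+ toℕ k) p∣np′)) ,
    (λ _ → refl) , e k , λ _ → ∣ᵤ-zero (+ r) (+-inverseʳ (e k))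

  scalar-injective : ∀ k l → QEq r q (scalar k) (scalar l) → k ≡ l
  scalar-injective k l (_ , c , r∣qc , r∣eₖ-eₗ-c) =
    toℕ-injective (<-∣-sub⇒≡ (toℕ<n k) (toℕ<n l)
      (*-cancelˡ-∣ (+ p′) (*-cancelˡ-∣ (+ q)
        (subst₂ _∣_ (trans r≡qMp′ (cong (_*_ (+ q)) (*-comm (+ M) (+ p′))))
                    (cong (_*_ (+ q)) (factor (+ p′) (+ toℕ k) (+ toℕ l)))
                    r∣qp′[k-l]))))
    where
    i₀ : Fin n
    i₀ = fromℕ< (ℕ.>-nonZero⁻¹ n)
    r∣qp′[k-l] : + r ∣ + q * (e k - e l)
    r∣qp′[k-l] = ∣-≡ (lemma (+ q) (e k) (e l) c)
      (∣m∣n⇒∣m+n (∣n⇒∣m*n (+ q) (signed (+ r) (e k - e l - c) (r∣eₖ-eₗ-c i₀)))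
                 (signed (+ r) (+ q * c) r∣qc))
      where
      lemma : ∀ q eₖ eₗ c → q * (eₖ - eₗ - c) + q * c ≡ q * (eₖ - eₗ)
      lemma = solve-∀
    factor : ∀ p k l → p * k - p * l ≡ p * (k - l)
    factor = solve-∀

  scalar-surjective : ∀ x → InG p x → IsScalarMat r x → Σ (Fin M) λ k → QEq r q x (scalar k)
  scalar-surjective (σ , a) x∈G (σ≗id , c₀ , r∣a-c₀) = k , σ≗id , c , r∣qc , r∣a-eₖ-c
    where
    S : ℤ
    S = sumℤ a
    r∣S-nc₀ : + r ∣ S - + n * c₀
    r∣S-nc₀ = ∣-≡ (sumℤ-sub-const a c₀) (sumℤ-∣ _ (λ i → signed (+ r) (a i - c₀) (r∣a-c₀ i)))
    p∣nc₀ : + p ∣ + n * c₀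
    p∣nc₀ = ∣-≡ (lemma S (+ n * c₀)) (∣m∣n⇒∣m-n (signed (+ p) S x∈G) (∣-trans p∣r r∣S-nc₀))
      where
      lemma : ∀ s t → s - (s - t) ≡ t
      lemma = solve-∀
    j : ℤ
    j = quotient (p∣nc⇒p′∣c c₀ p∣nc₀)
    k : Fin M
    k = fromℕ< (n%ℕd<d j M)
    c : ℤ
    c = c₀ - e k
    r∣qc : + r ∣ᵤ + q * c
    r∣qc = ∣⇒∣ᵤ (divides (j /ℕ M) (begin
      + q * (c₀ - + p′ * + toℕ k)            ≡⟨ cong₂ (λ c₀ k → + q * (c₀ - + p′ * k))
                                                   (_∣_.equality (p∣nc⇒p′∣c c₀ p∣nc₀))
                                                   (cong +_ (toℕ-fromℕ< (n%ℕd<d j M))) ⟩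
      + q * (j * + p′ - + p′ * + (j %ℕ M))   ≡⟨ cong (λ j′ → + q * (j′ * + p′ - + p′ * + (j %ℕ M)))
                                                   (a≡a%ℕn+[a/ℕn]*n j M) ⟩
      + q * ((+ (j %ℕ M) + j /ℕ M * + M) * + p′ - + p′ * + (j %ℕ M))
                                             ≡⟨ lemma (+ q) (+ p′) (+ M) (+ (j %ℕ M)) (j /ℕ M) ⟩
      j /ℕ M * (+ q * (+ M * + p′))          ≡⟨ cong (_*_ (j /ℕ M)) r≡qMp′ ⟨
      j /ℕ M * + r                           ∎))
      where
      open ≡-Reasoning
      lemma : ∀ q p M m t → q * ((m + t * M) * p - p * m) ≡ t * (q * (M * p))
      lemma = solve-∀
    r∣a-eₖ-c : ∀ i → + r ∣ᵤ a i - e k - c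
    r∣a-eₖ-c i = subst (+ r ∣ᵤ_) (lemma (a i) c₀ (e k)) (r∣a-c₀ i)
      where
      lemma : ∀ a c₀ e → a - c₀ ≡ a - e - (c₀ - e)
      lemma = solve-∀

module Twist (p n : ℕ) .{{_ : NonZero p}} (k : ℤ) where

  -- Exact on G(r,p,n), where p divides the exponent sum; elsewhere /ℕ rounds down.
  level : Mono n → ℤ
  level x = sumℤ (exps x) /ℕ p

  twist : Mono n → Mono n
  twist (σ , a) = σ , λ i → a i + k * level (σ , a)

  sumℤ≡level*p : ∀ x → InG p x → sumℤ (exps x) ≡ level x * + p
  sumℤ≡level*p x x∈G = /ℕ-exact p (sumℤ (exps x)) (signed (+ p) _ x∈G)

  sumℤ-twist : ∀ x → InG p x → sumℤ (exps (twist x)) ≡ level x * (+ p + + n * k)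
  sumℤ-twist (σ , a) x∈G = begin
    sumℤ (λ i → a i + k * s)      ≡⟨ sumℤ-+ a (λ _ → k * s) ⟩
    sumℤ a + sumℤ {n} (λ _ → k * s) ≡⟨ cong₂ _+_ (sumℤ≡level*p (σ , a) x∈G) (sumℤ-const n (k * s)) ⟩
    s * + p + + n * (k * s)       ≡⟨ lemma s (+ p) (+ n) k ⟩
    s * (+ p + + n * k)           ∎
    where
    open ≡-Reasoning
    s : ℤ
    s = level (σ , a)
    lemma : ∀ s p n k → s * p + n * (k * s) ≡ s * (p + n * k)
    lemma = solve-∀

  level-mul : ∀ x y → InG p x → InG p y → level (mul x y) ≡ level x + level y
  level-mul x y x∈G y∈G = *-cancelʳ-≡ _ _ (+ p) (begin
    level (mul x y) * + p              ≡⟨ sumℤ≡level*p (mul x y) (InG-mul p x y x∈G y∈G) ⟨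
    sumℤ (exps (mul x y))              ≡⟨ sumℤ-exps-mul x y ⟩
    sumℤ (exps x) + sumℤ (exps y)      ≡⟨ cong₂ _+_ (sumℤ≡level*p x x∈G) (sumℤ≡level*p y y∈G) ⟩
    level x * + p + level y * + p      ≡⟨ *-distribʳ-+ (+ p) (level x) (level y) ⟨
    (level x + level y) * + p          ∎)
    where open ≡-Reasoning

  twist-hom : ∀ r q x y → InG p x → InG p y → QEq r q (twist (mul x y)) (mul (twist x) (twist y))
  twist-hom r q (σ , a) (τ , b) x∈G y∈G =
    (λ _ → refl) , 0ℤ , ∣ᵤ-zero (+ r) (*-zeroʳ (+ q)) ,
    λ i → ∣ᵤ-zero (+ r) (lemma (a i) (b (σ ⟨$⟩ʳ i)) k (level-mul (σ , a) (τ , b) x∈G y∈G))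
    where
    lemma : ∀ a b k {sxy sx sy} → sxy ≡ sx + sy →
            (a + b + k * sxy) - ((a + k * sx) + (b + k * sy)) - 0ℤ ≡ 0ℤ
    lemma a b k {_} {sx} {sy} refl = solve (a ∷ b ∷ k ∷ sx ∷ sy ∷ [])

  module _ {q : ℕ} .{{_ : NonZero q}} {A : ℤ} (p+nk≡qA : + p + + n * k ≡ + q * A) where

    sumℤ-twist≡level*A*q : ∀ x → InG p x → sumℤ (exps (twist x)) ≡ level x * A * + q
    sumℤ-twist≡level*A*q x x∈G = trans (sumℤ-twist x x∈G)
      (trans (cong (_*_ (level x)) p+nk≡qA) (lemma (level x) (+ q) A))
      where
      lemma : ∀ s q A → s * (q * A) ≡ s * A * q
      lemma = solve-∀

    twist-mem : ∀ x → InG p x → InG q (twist x)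
    twist-mem x x∈G = ∣⇒∣ᵤ (divides (level x * A) (sumℤ-twist≡level*A*q x x∈G))

    level-twist : ∀ x → InG p x → sumℤ (exps (twist x)) /ℕ q ≡ level x * A
    level-twist x x∈G = *-cancelʳ-≡ _ _ (+ q)
      (trans (sym (/ℕ-exact q _ (signed (+ q) _ (twist-mem x x∈G)))) (sumℤ-twist≡level*A*q x x∈G))

    twist-cong : ∀ r x y → InG p x → InG p y → QEq r q x y → QEq r p (twist x) (twist y)
    twist-cong r (σ , a) (τ , b) x∈G y∈G (σ≗τ , c , r∣qc , r∣a-b-c) =
      σ≗τ , c′ , ∣⇒∣ᵤ (∣-≡ (sym p*c′≡) r∣A[qc]+kD) , r∣shifted
      where
      sx sy c′ D : ℤ
      sx = level (σ , a)
      sy = level (τ , b)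
      c′ = c + k * (sx - sy)
      D = sumℤ (λ i → a i - b i - c)
      D≡ : D ≡ sx * + p - sy * + p - + n * c
      D≡ = begin
        D                                      ≡⟨ sumℤ-sub-const (λ i → a i - b i) c ⟩
        sumℤ (λ i → a i - b i) - + n * c       ≡⟨ cong (_- + n * c) (sumℤ-sub a b) ⟩
        sumℤ a - sumℤ b - + n * c              ≡⟨ cong₂ (λ u v → u - v - + n * c)
                                                    (sumℤ≡level*p (σ , a) x∈G) (sumℤ≡level*p (τ , b) y∈G) ⟩
        sx * + p - sy * + p - + n * c          ∎
        where open ≡-Reasoning
      p*c′≡ : + p * c′ ≡ A * (+ q * c) + k * D
      p*c′≡ = trans (≡-by-relation c (lemma (+ p) (+ n) k (+ q) A c sx sy) p+nk≡qA)
                    (cong (λ d → A * (+ q * c) + k * d) (sym D≡))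
        where
        lemma : ∀ p n k q A c sx sy →
                p * (c + k * (sx - sy)) - (A * (q * c) + k * (sx * p - sy * p - n * c))
                ≡ c * ((p + n * k) - q * A)
        lemma = solve-∀
      r∣A[qc]+kD : + r ∣ A * (+ q * c) + k * D
      r∣A[qc]+kD = ∣m∣n⇒∣m+n (∣n⇒∣m*n A (signed (+ r) (+ q * c) r∣qc))
                             (∣n⇒∣m*n k (sumℤ-∣ _ (λ i → signed (+ r) (a i - b i - c) (r∣a-b-c i))))
      r∣shifted : ∀ i → + r ∣ᵤ (a i + k * sx) - (b i + k * sy) - c′
      r∣shifted i = subst (+ r ∣ᵤ_) (lemma (a i) (b i) c k sx sy) (r∣a-b-c i)
        where
        lemma : ∀ a b c k sx sy → a - b - c ≡ (a + k * sx) - (b + k * sy) - (c + k * (sx - sy))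
        lemma = solve-∀

module _ {r p q n : ℕ} .{{_ : NonZero p}} .{{_ : NonZero q}} {k A k′ : ℤ}
         (p+nk≡qA : + p + + n * k ≡ + q * A)
         (r∣X : + r ∣ + q * k + + p * k′ + + n * k * k′) where
  open Twist p n k  using (twist; level; twist-mem; level-twist)
  open Twist q n k′ using () renaming (twist to twist′; level to level′)

  twist-twist≈id : ∀ x → InG p x → QEq r q (twist′ (twist x)) x
  twist-twist≈id (σ , a) x∈G =
    (λ _ → refl) , c , ∣⇒∣ᵤ (∣-≡ (sym q*c≡) (∣n⇒∣m*n s r∣X)) ,
    λ i → ∣ᵤ-zero (+ r) (lemma (a i) k s k′ t)
    where
    s t c : ℤ
    s = level (σ , a)
    t = level′ (twist (σ , a))
    c = k * s + k′ * t
    q*c≡ : + q * c ≡ s * (+ q * k + + p * k′ + + n * k * k′)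
    q*c≡ = ≡-by-relation (- (s * k′))
      (trans (cong (λ t → + q * (k * s + k′ * t) - s * (+ q * k + + p * k′ + + n * k * k′))
                   (level-twist p+nk≡qA (σ , a) x∈G))
             (algebra (+ p) (+ q) (+ n) k k′ s A))
      p+nk≡qA
      where
      algebra : ∀ p q n k k′ s A →
        q * (k * s + k′ * (s * A)) - s * (q * k + p * k′ + n * k * k′) ≡ - (s * k′) * ((p + n * k) - q * A)
      algebra = solve-∀
    lemma : ∀ a k s k′ t → (a + k * s) + k′ * t - a - (k * s + k′ * t) ≡ 0ℤ
    lemma = solve-∀

record TwistData (r p q n : ℕ) : Set where
  field
    k A k′ B : ℤ
    p+nk≡qA  : + p + + n * k ≡ + q * A
    q+nk′≡pB : + q + + n * k′ ≡ + p * B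
    r∣X      : + r ∣ + q * k + + p * k′ + + n * k * k′

twist-iso : ∀ {r p q n} .{{_ : NonZero p}} .{{_ : NonZero q}} → TwistData r p q n → GroupIso r p q r q p n
twist-iso {r} {p} {q} {n} record { k = k ; k′ = k′ ; p+nk≡qA = p+nk≡qA ; q+nk′≡pB = q+nk′≡pB ; r∣X = r∣X } = record
  { f      = twist
  ; f-mem  = twist-mem p+nk≡qA
  ; f-cong = twist-cong p+nk≡qA r
  ; f-hom  = twist-hom r p
  ; f-inj  = λ x y x∈G y∈G twist-x≈twist-y → begin
      x                   ≈⟨ twist-twist≈id p+nk≡qA r∣X x x∈G ⟨
      twist′ (twist x)    ≈⟨ twist-cong′ q+nk′≡pB r (twist x) (twist y) (twist-mem p+nk≡qA x x∈G)
                               (twist-mem p+nk≡qA y y∈G) twist-x≈twist-y ⟩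
      twist′ (twist y)    ≈⟨ twist-twist≈id p+nk≡qA r∣X y y∈G ⟩
      y                   ∎
  ; f-surj = λ y y∈G* → twist′ y , twist-mem′ q+nk′≡pB y y∈G* , twist-twist≈id q+nk′≡pB r∣X′ y y∈G*
  }
  where
  open Twist p n k  using (twist; twist-mem; twist-cong; twist-hom)
  open Twist q n k′ using () renaming (twist to twist′; twist-mem to twist-mem′; twist-cong to twist-cong′)
  open import Relation.Binary.Reasoning.Setoid (QEq-setoid r q {n})
  r∣X′ : + r ∣ + p * k′ + + q * k + + n * k′ * k
  r∣X′ = ∣-≡ (lemma (+ p) (+ q) (+ n) k k′) r∣X
    where
    lemma : ∀ p q n k k′ → q * k + p * k′ + n * k * k′ ≡ p * k′ + q * k + n * k′ * k
    lemma = solve-∀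

pos-1+*≡* : ∀ u v s t → 1 ℕ.+ u ℕ.* v ≡ s ℕ.* t → 1ℤ + + u * + v ≡ + s * + t
pos-1+*≡* u v s t 1+uv≡st = begin
  1ℤ + + u * + v     ≡⟨ cong (_+_ 1ℤ) (pos-* u v) ⟨
  1ℤ + + (u ℕ.* v)   ≡⟨ pos-+ 1 (u ℕ.* v) ⟨
  + (1 ℕ.+ u ℕ.* v)  ≡⟨ cong +_ 1+uv≡st ⟩
  + (s ℕ.* t)        ≡⟨ pos-* s t ⟩
  + s * + t          ∎
  where open ≡-Reasoning

Invertible : ℕ → ℤ → Set
Invertible m A = Σ ℤ λ B → Σ ℤ λ w → A * B ≡ 1ℤ + w * + m

coprime⇒invertible⁺ : ∀ a m → Coprime a m → Invertible m (+ a)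
coprime⇒invertible⁺ a m a⊥m with ℕC.coprime-Bézout a⊥m
... | Bézout.+- x y 1+ym≡xa = + x , + y , trans (*-comm (+ a) (+ x)) (sym (pos-1+*≡* y m x a 1+ym≡xa))
... | Bézout.-+ x y 1+xa≡ym =
  - + x , - + y , ≡-by-relation (- 1ℤ) (lemma (+ a) (+ x) (+ y) (+ m)) (pos-1+*≡* x a y m 1+xa≡ym)
  where
  lemma : ∀ a x y m → a * - x - (1ℤ + - y * m) ≡ - 1ℤ * ((1ℤ + x * a) - y * m)
  lemma = solve-∀

coprime⇒invertible : ∀ A m → Coprime ∣ A ∣ m → Invertible m A
coprime⇒invertible A m ∣A∣⊥m with coprime⇒invertible⁺ ∣ A ∣ m ∣A∣⊥m | +∣i∣≡i⊎+∣i∣≡-i A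
... | B , w , ∣A∣B≡1+wm | inj₁ ∣A∣≡A  = B , w , subst (λ A → A * B ≡ _) ∣A∣≡A ∣A∣B≡1+wm
... | B , w , ∣A∣B≡1+wm | inj₂ ∣A∣≡-A =
  - B , w , trans (lemma A B) (subst (λ A → A * B ≡ _) ∣A∣≡-A ∣A∣B≡1+wm)
  where
  lemma : ∀ A B → A * - B ≡ - A * B
  lemma = solve-∀

-- The part of L made of the primes that do not divide a.
record CoprimePart (a L : ℕ) : Set where
  field
    part    : ℕ
    part⊥a  : Coprime part a
    covers  : ∀ d → d ∣ℕ L → Coprime d a → Coprime d part → d ≡ 1

coprime-part : ∀ a L → 0 ℕ.< L → CoprimePart a L
coprime-part a = <-rec (λ L → 0 ℕ.< L → CoprimePart a L) step
  where
  step : ∀ L → (∀ {L′} → L′ ℕ.< L → 0 ℕ.< L′ → CoprimePart a L′) → 0 ℕ.< L → CoprimePart a L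
  step L part-below L>0 with gcd L a ℕₚ.≟ 1
  ... | yes gcd≡1 = record
    { part = L ; part⊥a = ℕC.gcd≡1⇒coprime gcd≡1 ; covers = λ d d∣L _ d⊥L → d⊥L (ℕ∣.∣-refl , d∣L) }
  ... | no  gcd≢1 = record
    { part = part ; part⊥a = part⊥a ; covers = λ d d∣L d⊥a → covers d (d∣L′ d∣L d⊥a) d⊥a }
    where
    g L′ : ℕ
    g = gcd L a
    L′ = ℕ∣._∣_.quotient (gcd[m,n]∣m L a)
    L≡L′g : L ≡ L′ ℕ.* g
    L≡L′g = ℕ∣._∣_.equality (gcd[m,n]∣m L a)
    L′>0 : 0 ℕ.< L′
    L′>0 = ℕₚ.n≢0⇒n>0 λ L′≡0 → ℕₚ.<⇒≢ L>0 (sym (trans L≡L′g (cong (ℕ._* g) L′≡0)))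
    1<g : 1 ℕ.< g
    1<g with g | gcd[m,n]≡0⇒m≡0 {L} {a}
    ... | 0           | g≡0⇒L≡0 = contradiction (g≡0⇒L≡0 refl) (ℕₚ.<⇒≢ L>0 ∘ sym)
    ... | 1           | _       = contradiction refl gcd≢1
    ... | suc (suc _) | _       = ℕ.s≤s (ℕ.s≤s ℕ.z≤n)
    L′<L : L′ ℕ.< L
    L′<L = subst (L′ ℕ.<_) (sym L≡L′g) (ℕₚ.m<m*n L′ g {{ℕ.>-nonZero L′>0}} 1<g)
    open CoprimePart (part-below L′<L L′>0)
    d∣L′ : ∀ {d} → d ∣ℕ L → Coprime d a → d ∣ℕ L′
    d∣L′ d∣L d⊥a = ℕC.coprime-divisor (λ (e∣d , e∣g) → d⊥a (e∣d , ℕ∣.∣-trans e∣g (gcd[m,n]∣n L a)))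
                                      (subst (_ ∣ℕ_) (trans L≡L′g (ℕₚ.*-comm L′ g)) d∣L)

-- A common divisor of a₀ + m part and L is coprime to a₀ (it would divide m part, where m ⊥ a₀
-- and part ⊥ a₀) and to part (it would divide a₀), so it is 1.
coprime-shift : ∀ a₀ m L → 0 ℕ.< L → Coprime ∣ a₀ ∣ m → Σ ℤ λ t → Coprime ∣ a₀ + + m * t ∣ L
coprime-shift a₀ m L L>0 a₀⊥m = + part , λ (d∣A , d∣L) → covers _ d∣L (d⊥a₀ d∣A) (d⊥part d∣A)
  where
  open CoprimePart (coprime-part ∣ a₀ ∣ L L>0)
  A : ℤ
  A = a₀ + + m * + part
  d⊥a₀ : ∀ {d} → d ∣ℕ ∣ A ∣ → Coprime d ∣ a₀ ∣
  d⊥a₀ {d} d∣A {e} (e∣d , e∣a₀) = part⊥a (e∣part , e∣a₀)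
    where
    e∣m*part : + e ∣ + m * + part
    e∣m*part = ∣-≡ (lemma a₀ (+ m * + part))
      (∣m∣n⇒∣m-n (signed (+ e) A (ℕ∣.∣-trans e∣d d∣A)) (signed (+ e) a₀ e∣a₀))
      where
      lemma : ∀ a x → a + x - a ≡ x
      lemma = solve-∀
    e∣part : e ∣ℕ part
    e∣part = ℕC.coprime-divisor (λ (f∣e , f∣m) → a₀⊥m (ℕ∣.∣-trans f∣e e∣a₀ , f∣m))
               (subst (e ∣ℕ_) (abs-* (+ m) (+ part)) (∣⇒∣ᵤ e∣m*part))
  d⊥part : ∀ {d} → d ∣ℕ ∣ A ∣ → Coprime d part
  d⊥part {d} d∣A {e} (e∣d , e∣part) = part⊥a (e∣part , ∣⇒∣ᵤ e∣a₀)
    where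
    e∣a₀ : + e ∣ a₀
    e∣a₀ = ∣-≡ (lemma a₀ (+ m * + part))
      (∣m∣n⇒∣m-n (signed (+ e) A (ℕ∣.∣-trans e∣d d∣A)) (∣n⇒∣m*n (+ m) (signed (+ e) (+ part) e∣part)))
      where
      lemma : ∀ a x → a + x - x ≡ a
      lemma = solve-∀
-- A ≡ p′/q′ modulo n′ is made invertible modulo N n′; its inverse B then satisfies p′ B ≡ q′.
reduced-twist-parameters : ∀ p′ q′ n′ N .{{_ : NonZero N}} .{{_ : NonZero n′}} →
  Coprime p′ n′ → Coprime q′ n′ →
  Σ ℤ λ k → Σ ℤ λ A → Σ ℤ λ k′ → Σ ℤ λ B → Σ ℤ λ w →
    (+ p′ + + n′ * k ≡ + q′ * A) × (+ q′ + + n′ * k′ ≡ + p′ * B) × (A * B ≡ 1ℤ + w * (+ N * + n′))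
reduced-twist-parameters p′ q′ n′ N p′⊥n′ q′⊥n′ =
  k , A , k′ , B , w , p′+n′k≡q′A , q′+n′k′≡p′B , AB≡1+wNn′
  where
  u w₁ : ℤ
  u  = proj₁ (coprime⇒invertible⁺ q′ n′ q′⊥n′)
  w₁ = proj₁ (proj₂ (coprime⇒invertible⁺ q′ n′ q′⊥n′))
  q′u≡1+w₁n′ : + q′ * u ≡ 1ℤ + w₁ * + n′
  q′u≡1+w₁n′ = proj₂ (proj₂ (coprime⇒invertible⁺ q′ n′ q′⊥n′))
  p′u⊥n′ : Coprime ∣ + p′ * u ∣ n′
  p′u⊥n′ {e} (e∣p′u , e∣n′) = ℕ∣.∣1⇒≡1 (∣⇒∣ᵤ (∣-≡ q′u-w₁n′≡1 e∣q′u-w₁n′))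
    where
    e∣u : e ∣ℕ ∣ u ∣
    e∣u = ℕC.coprime-divisor (λ (f∣e , f∣p′) → p′⊥n′ (f∣p′ , ℕ∣.∣-trans f∣e e∣n′))
                             (subst (e ∣ℕ_) (abs-* (+ p′) u) e∣p′u)
    e∣q′u-w₁n′ : + e ∣ + q′ * u - w₁ * + n′
    e∣q′u-w₁n′ = ∣m∣n⇒∣m-n (∣n⇒∣m*n (+ q′) (signed (+ e) u e∣u)) (∣n⇒∣m*n w₁ (signed (+ e) (+ n′) e∣n′))
    q′u-w₁n′≡1 : + q′ * u - w₁ * + n′ ≡ 1ℤ
    q′u-w₁n′≡1 = ≡-by-relation 1ℤ (lemma (+ q′) u w₁ (+ n′)) q′u≡1+w₁n′
      where
      lemma : ∀ q u w n → q * u - w * n - 1ℤ ≡ 1ℤ * (q * u - (1ℤ + w * n))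
      lemma = solve-∀
  L : ℕ
  L = N ℕ.* n′
  L>0 : 0 ℕ.< L
  L>0 = ℕ.>-nonZero⁻¹ L {{ℕₚ.m*n≢0 N n′}}
  t A : ℤ
  t = proj₁ (coprime-shift (+ p′ * u) n′ L L>0 p′u⊥n′)
  A = + p′ * u + + n′ * t
  A⊥L : Coprime ∣ A ∣ L
  A⊥L = proj₂ (coprime-shift (+ p′ * u) n′ L L>0 p′u⊥n′)
  B w k k′ : ℤ
  B = proj₁ (coprime⇒invertible A L A⊥L)
  w = proj₁ (proj₂ (coprime⇒invertible A L A⊥L))
  k = + p′ * w₁ + + q′ * t
  k′ = + q′ * w * + N - k * B
  AB≡1+wNn′ : A * B ≡ 1ℤ + w * (+ N * + n′)
  AB≡1+wNn′ = trans (proj₂ (proj₂ (coprime⇒invertible A L A⊥L))) (cong (λ x → 1ℤ + w * x) (pos-* N n′))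
  p′+n′k≡q′A : + p′ + + n′ * k ≡ + q′ * A
  p′+n′k≡q′A = begin
    + p′ + + n′ * (+ p′ * w₁ + + q′ * t)        ≡⟨ lemma₁ (+ p′) (+ q′) (+ n′) w₁ t ⟩
    + p′ * (1ℤ + w₁ * + n′) + + q′ * (+ n′ * t) ≡⟨ cong (λ x → + p′ * x + + q′ * (+ n′ * t)) q′u≡1+w₁n′ ⟨
    + p′ * (+ q′ * u) + + q′ * (+ n′ * t)       ≡⟨ lemma₂ (+ p′) (+ q′) (+ n′) u t ⟩
    + q′ * A                                    ∎
    where
    open ≡-Reasoning
    lemma₁ : ∀ p q n w t → p + n * (p * w + q * t) ≡ p * (1ℤ + w * n) + q * (n * t)
    lemma₁ = solve-∀
    lemma₂ : ∀ p q n u t → p * (q * u) + q * (n * t) ≡ q * (p * u + n * t)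
    lemma₂ = solve-∀
  q′+n′k′≡p′B : + q′ + + n′ * k′ ≡ + p′ * B
  q′+n′k′≡p′B = begin
    + q′ + + n′ * (+ q′ * w * + N - k * B)     ≡⟨ lemma₁ (+ q′) (+ n′) (+ N) w k B ⟩
    + q′ * (1ℤ + w * (+ N * + n′)) - + n′ * k * B ≡⟨ cong (λ x → + q′ * x - + n′ * k * B) AB≡1+wNn′ ⟨
    + q′ * (A * B) - + n′ * k * B              ≡⟨ lemma₂ (+ q′) (+ n′) A B k ⟩
    (+ q′ * A - + n′ * k) * B                  ≡⟨ cong (λ x → (x - + n′ * k) * B) p′+n′k≡q′A ⟨
    (+ p′ + + n′ * k - + n′ * k) * B           ≡⟨ lemma₃ (+ p′) (+ n′ * k) B ⟩
    + p′ * B                                   ∎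
    where
    open ≡-Reasoning
    lemma₁ : ∀ q n N w k B → q + n * (q * w * N - k * B) ≡ q * (1ℤ + w * (N * n)) - n * k * B
    lemma₁ = solve-∀
    lemma₂ : ∀ q n A B k → q * (A * B) - n * k * B ≡ (q * A - n * k) * B
    lemma₂ = solve-∀
    lemma₃ : ∀ p x B → (p + x - x) * B ≡ p * B
    lemma₃ = solve-∀

pos-scale : ∀ a b c g {k A} → + a + + b * k ≡ + c * A → + (a ℕ.* g) + + (b ℕ.* g) * k ≡ + (c ℕ.* g) * A
pos-scale a b c g {k} {A} a+bk≡cA = begin
  + (a ℕ.* g) + + (b ℕ.* g) * k  ≡⟨ cong₂ (λ x y → x + y * k) (pos-* a g) (pos-* b g) ⟩
  + a * + g + + b * + g * k      ≡⟨ lemma₁ (+ a) (+ b) (+ g) k ⟩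
  (+ a + + b * k) * + g          ≡⟨ cong (_* + g) a+bk≡cA ⟩
  + c * A * + g                  ≡⟨ lemma₂ (+ c) A (+ g) ⟩
  + c * + g * A                  ≡⟨ cong (_* A) (pos-* c g) ⟨
  + (c ℕ.* g) * A                ∎
  where
  open ≡-Reasoning
  lemma₁ : ∀ a b g k → a * g + b * g * k ≡ (a + b * k) * g
  lemma₁ = solve-∀
  lemma₂ : ∀ c A g → c * A * g ≡ c * g * A
  lemma₂ = solve-∀

-- (p + n k)(q + n k′) = p q + n X gives n X = p q (A B - 1), and r n = N p q.
twist-divisibility : ∀ {r p q n N n′} .{{_ : NonZero n}} {k A k′ B w} →
  + p + + n * k ≡ + q * A → + q + + n * k′ ≡ + p * B → A * B ≡ 1ℤ + w * (+ N * + n′) →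
  r ℕ.* n ≡ N ℕ.* (p ℕ.* q) → + r ∣ + q * k + + p * k′ + + n * k * k′
twist-divisibility {r} {p} {q} {n} {N} {n′} {k} {A} {k′} {B} {w} p+nk≡qA q+nk′≡pB AB≡1+wNn′ rn≡Npq =
  divides (w * + n′) (*-cancelˡ-≡ (+ n) _ _ (begin
    + n * (+ q * k + + p * k′ + + n * k * k′)        ≡⟨ lemma₁ (+ p) (+ q) (+ n) k k′ ⟩
    (+ p + + n * k) * (+ q + + n * k′) - + p * + q   ≡⟨ cong₂ (λ x y → x * y - + p * + q) p+nk≡qA q+nk′≡pB ⟩
    + q * A * (+ p * B) - + p * + q                  ≡⟨ lemma₂ (+ p) (+ q) A B ⟩
    + p * + q * (A * B) - + p * + q                  ≡⟨ cong (λ x → + p * + q * x - + p * + q) AB≡1+wNn′ ⟩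
    + p * + q * (1ℤ + w * (+ N * + n′)) - + p * + q ≡⟨ lemma₃ (+ p) (+ q) (+ N) (+ n′) w ⟩
    w * + n′ * (+ N * (+ p * + q))                   ≡⟨ cong (λ x → w * + n′ * x) Npq≡rn ⟩
    w * + n′ * (+ r * + n)                           ≡⟨ lemma₄ (+ r) (+ n) (+ n′) w ⟩
    + n * (w * + n′ * + r)                           ∎))
  where
  open ≡-Reasoning
  Npq≡rn : + N * (+ p * + q) ≡ + r * + n
  Npq≡rn = begin
    + N * (+ p * + q)     ≡⟨ cong (_*_ (+ N)) (pos-* p q) ⟨
    + N * + (p ℕ.* q)     ≡⟨ pos-* N (p ℕ.* q) ⟨
    + (N ℕ.* (p ℕ.* q))   ≡⟨ cong +_ rn≡Npq ⟨
    + (r ℕ.* n)           ≡⟨ pos-* r n ⟩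
    + r * + n             ∎
  lemma₁ : ∀ p q n k k′ → n * (q * k + p * k′ + n * k * k′) ≡ (p + n * k) * (q + n * k′) - p * q
  lemma₁ = solve-∀
  lemma₂ : ∀ p q A B → q * A * (p * B) - p * q ≡ p * q * (A * B) - p * q
  lemma₂ = solve-∀
  lemma₃ : ∀ p q N n′ w → p * q * (1ℤ + w * (N * n′)) - p * q ≡ w * n′ * (N * (p * q))
  lemma₃ = solve-∀
  lemma₄ : ∀ r n n′ w → w * n′ * (r * n) ≡ n * (w * n′ * r)
  lemma₄ = solve-∀

twist-data : ∀ {r p q n g p′ q′ n′ N} .{{_ : NonZero r}} .{{_ : NonZero n}} →
  p ≡ p′ ℕ.* g → q ≡ q′ ℕ.* g → n ≡ n′ ℕ.* g → Coprime p′ n′ → Coprime q′ n′ →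
  r ℕ.* n ≡ N ℕ.* (p ℕ.* q) → TwistData r p q n
twist-data {r} {g = g} {p′} {q′} {n′} {N} refl refl refl p′⊥n′ q′⊥n′ rn≡Npq =
  case reduced-twist-parameters p′ q′ n′ N p′⊥n′ q′⊥n′ of λ where
    (k , A , k′ , B , w , p′+n′k≡q′A , q′+n′k′≡p′B , AB≡1+wNn′) →
      let p+nk≡qA : + (p′ ℕ.* g) + + (n′ ℕ.* g) * k ≡ + (q′ ℕ.* g) * A
          p+nk≡qA = pos-scale p′ n′ q′ g p′+n′k≡q′A
          q+nk′≡pB : + (q′ ℕ.* g) + + (n′ ℕ.* g) * k′ ≡ + (p′ ℕ.* g) * B
          q+nk′≡pB = pos-scale q′ n′ p′ g q′+n′k′≡p′B
      in record
        { k = k ; A = A ; k′ = k′ ; B = B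
        ; p+nk≡qA  = p+nk≡qA
        ; q+nk′≡pB = q+nk′≡pB
        ; r∣X      = twist-divisibility {N = N} {n′} {w = w} p+nk≡qA q+nk′≡pB AB≡1+wNn′ rn≡Npq
        }
  where
  instance
    N≢0 : NonZero N
    N≢0 = ≢-nonZero λ N≡0 → ≢-nonZero⁻¹ (r ℕ.* (n′ ℕ.* g)) {{ℕₚ.m*n≢0 r (n′ ℕ.* g)}}
                              (trans rn≡Npq (cong (ℕ._* _) N≡0))
    n′≢0 : NonZero n′
    n′≢0 = ℕₚ.m*n≢0⇒m≢0 n′

record GcdSplit (p n : ℕ) : Set where
  field
    g p′ n′ : ℕ
    p≡p′g : p ≡ p′ ℕ.* g
    n≡n′g : n ≡ n′ ℕ.* g
    p′⊥n′ : Coprime p′ n′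

gcd-split : ∀ p n .{{_ : NonZero p}} → GcdSplit p n
gcd-split p n = record
  { g = gcd p n ; p′ = p / gcd p n ; n′ = n / gcd p n
  ; p≡p′g = sym (m/n*n≡m (gcd[m,n]∣m p n))
  ; n≡n′g = sym (m/n*n≡m (gcd[m,n]∣n p n))
  ; p′⊥n′ = ℕC.coprime-/gcd p n
  }
  where instance
  gcd≢0 : NonZero (gcd p n)
  gcd≢0 = ≢-nonZero (gcd[m,n]≢0 p n (inj₁ (≢-nonZero⁻¹ p)))

module _ {p n : ℕ} .{{_ : NonZero p}} (s : GcdSplit p n) where
  open GcdSplit s

  p∣n*p′ : + p ∣ + n * + p′
  p∣n*p′ = divides (+ n′) (begin
    + n * + p′               ≡⟨ cong (λ m → + m * + p′) n≡n′g ⟩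
    + (n′ ℕ.* g) * + p′      ≡⟨ cong (_* + p′) (pos-* n′ g) ⟩
    + n′ * + g * + p′        ≡⟨ lemma (+ n′) (+ g) (+ p′) ⟩
    + n′ * (+ p′ * + g)      ≡⟨ cong (_*_ (+ n′)) (pos-* p′ g) ⟨
    + n′ * + (p′ ℕ.* g)      ≡⟨ cong (λ m → + n′ * + m) p≡p′g ⟨
    + n′ * + p               ∎)
    where
    open ≡-Reasoning
    lemma : ∀ n g p → n * g * p ≡ n * (p * g)
    lemma = solve-∀

  p∣n*c⇒p′∣c : ∀ c → + p ∣ + n * c → + p′ ∣ c
  p∣n*c⇒p′∣c c p∣nc = signed (+ p′) c (ℤC.coprime-divisor (+ p′) (+ n′) c p′⊥n′ (∣⇒∣ᵤ p′∣n′c))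
    where
    instance
      g≢0 : NonZero g
      g≢0 = ≢-nonZero λ g≡0 →
        ≢-nonZero⁻¹ p (trans p≡p′g (trans (cong (p′ ℕ.*_) g≡0) (ℕₚ.*-zeroʳ p′)))
    p′∣n′c : + p′ ∣ + n′ * c
    p′∣n′c = *-cancelˡ-∣ (+ g) (subst₂ _∣_ (trans (cong +_ p≡p′g) (trans (pos-* p′ g) (*-comm (+ p′) (+ g))))
      (trans (cong (λ m → + m * c) n≡n′g) (trans (cong (_* c) (pos-* n′ g)) (lemma (+ n′) (+ g) c))) p∣nc)
      where
      lemma : ∀ n g c → n * g * c ≡ g * (n * c)
      lemma = solve-∀

nonZero-middle : ∀ {r} q M p′ .{{_ : NonZero r}} → r ≡ q ℕ.* (M ℕ.* p′) → NonZero M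
nonZero-middle {r} q M p′ r≡qMp′ = ≢-nonZero λ M≡0 →
  ≢-nonZero⁻¹ r (trans r≡qMp′ (trans (cong (λ m → q ℕ.* (m ℕ.* p′)) M≡0) (ℕₚ.*-zeroʳ q)))

scalar-count : ∀ {r p q n} .{{_ : NonZero r}} .{{_ : NonZero p}} .{{_ : NonZero q}} .{{_ : NonZero n}} →
  p ∣ℕ r → q ∣ℕ r → p ℕ.* q ∣ℕ r ℕ.* n → (s : GcdSplit p n) →
  Σ ℕ λ M → r ≡ q ℕ.* (M ℕ.* GcdSplit.p′ s) × ScalarCount r p q n M
scalar-count {r} {q = q} p∣r (ℕ∣.divides R r≡Rq) (ℕ∣.divides X rn≡Xpq)
  s@record { g = g ; p′ = p′ ; n′ = n′ ; p≡p′g = refl ; n≡n′g = refl ; p′⊥n′ = p′⊥n′ } =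
  M , r≡qMp′ , ScalarCount-of-generator r≡qMp′ᶻ (∣ᵤ⇒∣ p∣r) (p∣n*p′ s) (p∣n*c⇒p′∣c s)
  where
  instance
    p′≢0 : NonZero p′
    p′≢0 = ℕₚ.m*n≢0⇒m≢0 p′
  n′R≡Xp′ : n′ ℕ.* R ≡ X ℕ.* p′
  n′R≡Xp′ = ℕₚ.*-cancelˡ-≡ _ _ (g ℕ.* q) {{ℕₚ.m*n≢0 g q {{ℕₚ.m*n≢0⇒n≢0 p′}}}} (begin
    g ℕ.* q ℕ.* (n′ ℕ.* R)       ≡⟨ ℕ-Solver.solve (g ∷ q ∷ n′ ∷ R ∷ []) ⟩
    R ℕ.* q ℕ.* (n′ ℕ.* g)       ≡⟨ cong (ℕ._* (n′ ℕ.* g)) r≡Rq ⟨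
    r ℕ.* (n′ ℕ.* g)             ≡⟨ rn≡Xpq ⟩
    X ℕ.* (p′ ℕ.* g ℕ.* q)       ≡⟨ ℕ-Solver.solve (X ∷ p′ ∷ g ∷ q ∷ []) ⟩
    g ℕ.* q ℕ.* (X ℕ.* p′)       ∎)
    where open ≡-Reasoning
  p′∣R : p′ ∣ℕ R
  p′∣R = ℕC.coprime-divisor p′⊥n′ (ℕ∣.divides X n′R≡Xp′)
  M : ℕ
  M = ℕ∣._∣_.quotient p′∣R
  r≡qMp′ : r ≡ q ℕ.* (M ℕ.* p′)
  r≡qMp′ = trans r≡Rq (trans (cong (ℕ._* q) (ℕ∣._∣_.equality p′∣R)) (ℕₚ.*-comm (M ℕ.* p′) q))
  r≡qMp′ᶻ : + r ≡ + q * (+ M * + p′)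
  r≡qMp′ᶻ = trans (cong +_ r≡qMp′) (trans (pos-* q (M ℕ.* p′)) (cong (_*_ (+ q)) (pos-* M p′)))
  instance
    M≢0 : NonZero M
    M≢0 = nonZero-middle q M p′ r≡qMp′

aligned-splits : ∀ {r p q n M} .{{_ : NonZero r}} .{{_ : NonZero p}} .{{_ : NonZero q}}
  (sp : GcdSplit p n) (sq : GcdSplit q n) →
  r ≡ q ℕ.* (M ℕ.* GcdSplit.p′ sp) → r ≡ p ℕ.* (M ℕ.* GcdSplit.p′ sq) →
  q ≡ GcdSplit.p′ sq ℕ.* GcdSplit.g sp × Coprime (GcdSplit.p′ sq) (GcdSplit.n′ sp)
aligned-splits {M = M}
  record { g = g₁ ; p′ = p′ ; n′ = n₁′ ; p≡p′g = refl ; n≡n′g = refl }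
  record { g = g₂ ; p′ = q′ ; n′ = n₂′ ; p≡p′g = refl ; n≡n′g = n₁′g₁≡n₂′g₂ ; p′⊥n′ = q′⊥n₂′ }
  r≡qMp′ r≡pMq′ = cong (q′ ℕ.*_) g₂≡g₁ , subst (Coprime q′) (sym n₁′≡n₂′) q′⊥n₂′
  where
  instance
    M≢0 : NonZero M
    M≢0 = nonZero-middle (q′ ℕ.* g₂) M p′ r≡qMp′
    p′≢0 : NonZero p′
    p′≢0 = ℕₚ.m*n≢0⇒m≢0 p′
    q′≢0 : NonZero q′
    q′≢0 = ℕₚ.m*n≢0⇒m≢0 q′
    g₁≢0 : NonZero g₁
    g₁≢0 = ℕₚ.m*n≢0⇒n≢0 p′
    Mp′q′≢0 : NonZero (M ℕ.* p′ ℕ.* q′)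
    Mp′q′≢0 = ℕₚ.m*n≢0 (M ℕ.* p′) q′ {{ℕₚ.m*n≢0 M p′}}
  g₂≡g₁ : g₂ ≡ g₁
  g₂≡g₁ = ℕₚ.*-cancelˡ-≡ g₂ g₁ (M ℕ.* p′ ℕ.* q′) (begin
    M ℕ.* p′ ℕ.* q′ ℕ.* g₂       ≡⟨ ℕ-Solver.solve (M ∷ p′ ∷ q′ ∷ g₂ ∷ []) ⟩
    q′ ℕ.* g₂ ℕ.* (M ℕ.* p′)     ≡⟨ trans (sym r≡qMp′) r≡pMq′ ⟩
    p′ ℕ.* g₁ ℕ.* (M ℕ.* q′)     ≡⟨ ℕ-Solver.solve (M ∷ p′ ∷ q′ ∷ g₁ ∷ []) ⟩
    M ℕ.* p′ ℕ.* q′ ℕ.* g₁       ∎)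
    where open ≡-Reasoning
  n₁′≡n₂′ : n₁′ ≡ n₂′
  n₁′≡n₂′ = ℕₚ.*-cancelʳ-≡ n₁′ n₂′ g₁ (trans n₁′g₁≡n₂′g₂ (cong (n₂′ ℕ.*_) g₂≡g₁))

corollary4p6 : (r p q n : ℕ) → 0 ℕ.< r → 0 ℕ.< p → 0 ℕ.< q → 0 ℕ.< n →
    p ∣ℕ r → q ∣ℕ r → (p ℕ.* q) ∣ℕ (r ℕ.* n) → n ≢ 2 →
    (GroupIso r p q r q p n
    ⇔ Σ ℕ (λ m → ScalarCount r p q n m × ScalarCount r q p n m))
corollary4p6 r p q n r>0 p>0 q>0 n>0 p∣r q∣r pq∣rn@(ℕ∣.divides N rn≡Npq) n≢2 = mk⇔
  (λ iso → M , count-G , iso-ScalarCount iso n≢2 count-G)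
  (λ (m , count-G′ , count-G*′) → twist-iso (twist-data {N = N}
      (GcdSplit.p≡p′g sp) (proj₁ (aligned count-G′ count-G*′))
      (GcdSplit.n≡n′g sp) (GcdSplit.p′⊥n′ sp) (proj₂ (aligned count-G′ count-G*′)) rn≡Npq))
  where
  instance
    r≢0 : NonZero r
    r≢0 = ℕ.>-nonZero r>0
    p≢0 : NonZero p
    p≢0 = ℕ.>-nonZero p>0
    q≢0 : NonZero q
    q≢0 = ℕ.>-nonZero q>0
    n≢0 : NonZero n
    n≢0 = ℕ.>-nonZero n>0
  sp : GcdSplit p n
  sp = gcd-split p n
  sq : GcdSplit q n
  sq = gcd-split q n
  M M* : ℕ
  M = proj₁ (scalar-count p∣r q∣r pq∣rn sp)
  M* = proj₁ (scalar-count q∣r p∣r (subst (_∣ℕ r ℕ.* n) (ℕₚ.*-comm p q) pq∣rn) sq)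
  count-G : ScalarCount r p q n M
  count-G = proj₂ (proj₂ (scalar-count p∣r q∣r pq∣rn sp))
  count-G* : ScalarCount r q p n M*
  count-G* = proj₂ (proj₂ (scalar-count q∣r p∣r (subst (_∣ℕ r ℕ.* n) (ℕₚ.*-comm p q) pq∣rn) sq))
  aligned : ∀ {m} → ScalarCount r p q n m → ScalarCount r q p n m →
            q ≡ GcdSplit.p′ sq ℕ.* GcdSplit.g sp × Coprime (GcdSplit.p′ sq) (GcdSplit.n′ sp)
  aligned count-G′ count-G*′ = aligned-splits {M = M} sp sq
    (proj₁ (proj₂ (scalar-count p∣r q∣r pq∣rn sp)))
    (trans (proj₁ (proj₂ (scalar-count q∣r p∣r (subst (_∣ℕ r ℕ.* n) (ℕₚ.*-comm p q) pq∣rn) sq)))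
           (cong (λ M′ → p ℕ.* (M′ ℕ.* GcdSplit.p′ sq))
                 (trans (ScalarCount-unique r q p n count-G* count-G*′)
                        (sym (ScalarCount-unique r p q n count-G count-G′)))))
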